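{- Let $S$ be a set, $f\colon 2^S\to 2^S$ monotonic with respect to $\subseteq$, and let $(X,\prec)$ be a support ordering for $f$ such that $\prec$ is well-founded. Then there is a well-ordering $\prec'\subseteq X\times X$ extending $\prec$ (i.e. $\prec\subseteq\prec'$) such that $(X,\prec')$ is a support ordering for $f$.
   Context: A support ordering for $f$ is a pair $(X,\prec)$ with $X\subseteq S$ and $\prec\subseteq X\times X$ such that for every $x\in X$, $x\in f(\{x'\in X\mid x'\prec x\})$. A relation $R$ on $X$ is well-founded if every nonempty subset of $X$ has an $R$-minimal element; it is a (strict) total order if it is irreflexive, transitive, and any two distinct elements are comparable; it is a well-ordering if it is total and well-founded. The Axiom of Choice is assumed. -}

module Defs where

open import Level using (Level; suc; _⊔_)
open import Data.Product using (Σ; ∃; _×_; _,_)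
open import Data.Sum using (_⊎_)
open import Relation.Nullary using (¬_; Dec)
open import Relation.Binary.PropositionalEquality using (_≡_)
open import Relation.Unary using (Pred; _⊆_; _∈_)
open import Relation.Binary using (Rel)
open import Data.Unit.Polymorphic using (⊤)

RelOn : ∀ {ℓ} {A : Set ℓ} → Pred A ℓ → Rel A ℓ → Set ℓ
RelOn X R = ∀ x y → R x y → X x × X y

Monotone : ∀ {ℓ} {S : Set ℓ} → (Pred S ℓ → Pred S ℓ) → Set (suc ℓ)
Monotone {ℓ} {S} f = ∀ (A B : Pred S ℓ) → A ⊆ B → f A ⊆ f B

SupportOrdering : ∀ {ℓ} {S : Set ℓ} → (Pred S ℓ → Pred S ℓ) → Pred S ℓ → Rel S ℓ → Set ℓ
SupportOrdering f X _≺_ =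
  RelOn X _≺_ × (∀ x → X x → f (λ x' → X x' × (x' ≺ x)) x)

WellFoundedOn : ∀ {ℓ} {A : Set ℓ} → Pred A ℓ → Rel A ℓ → Set (suc ℓ)
WellFoundedOn {ℓ} {A} X R =
  ∀ (P : Pred A ℓ) → P ⊆ X → (∃ λ x → P x) →
    ∃ λ x → P x × (∀ y → P y → ¬ R y x)

TotalOrderOn : ∀ {ℓ} {A : Set ℓ} → Pred A ℓ → Rel A ℓ → Set ℓ
TotalOrderOn X R =
  (∀ x → X x → ¬ R x x) ×
  (∀ x y z → X x → X y → X z → R x y → R y z → R x z) ×
  (∀ x y → X x → X y → ¬ x ≡ y → R x y ⊎ R y x)

WellOrderingOn : ∀ {ℓ} {A : Set ℓ} → Pred A ℓ → Rel A ℓ → Set (suc ℓ)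
WellOrderingOn X R = TotalOrderOn X R × WellFoundedOn X R

-- Classical ambient assumptions of the paper (ZFC), as explicit hypotheses:
-- excluded middle, and the Axiom of Choice in the form of the
-- well-ordering theorem (every type of the universe admits a well-ordering).
ExcludedMiddle : (ℓ : Level) → Set (suc ℓ)
ExcludedMiddle ℓ = (P : Set ℓ) → Dec P

WellOrderingTheorem : (ℓ : Level) → Set (suc ℓ)
WellOrderingTheorem ℓ = (A : Set ℓ) → Σ (Rel A ℓ) λ R → WellOrderingOn {ℓ} {A} (λ _ → ⊤) R

{-# OPTIONS --safe #-}
-- Compare elements of X by their ≺-rank, and break ties between elements of
-- equal rank with an arbitrary well-ordering W of S (Zermelo). Since ≺ lowers
-- the rank, the resulting order extends ≺; it is a well-ordering because ranks
-- are well-founded and W is. Enlarging the order only enlarges the sets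
-- {x' ∈ X | x' ≺ x}, so by monotonicity of f it stays a support ordering.
module Submission where

open import Defs
open import Level using (Level)
open import Data.Product using (Σ; ∃; _×_; _,_; proj₁; proj₂)
open import Data.Sum using (_⊎_; inj₁; inj₂; [_,_]′)
open import Data.Empty using (⊥-elim)
open import Data.Unit.Polymorphic using (⊤; tt)
open import Function using (id)
open import Relation.Nullary using (¬_; yes; no)
open import Relation.Nullary.Decidable using (decidable-stable)
open import Relation.Unary using (Pred)
open import Relation.Binary using (Rel; _⇒_)
open import Relation.Binary.PropositionalEquality using (_≡_)
open import Induction.WellFounded using (Acc; acc; acc-inverse; WellFounded; wf⇒asym; module All)

module _ {ℓ : Level} (em : ExcludedMiddle ℓ) {A : Set ℓ} {R : Rel A ℓ} where

  wellFoundedOn⇒wellFounded : {X : Pred A ℓ} → RelOn X R → WellFoundedOn X R → WellFounded R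
  wellFoundedOn⇒wellFounded {X} onX wfOn x with em (Acc R x)
  ... | yes accessible = accessible
  ... | no inaccessible with em (X x)
  ...   | no x∉X = acc λ {y} yRx → ⊥-elim (x∉X (proj₂ (onX y x yRx)))
  ...   | yes x∈X with wfOn (λ z → X z × ¬ Acc R z) proj₁ (x , x∈X , inaccessible)
  ...     | (m , (_ , inaccessibleₘ) , minimal) = ⊥-elim (inaccessibleₘ (acc λ {y} yRm →
              decidable-stable (em (Acc R y)) λ ¬accy → minimal y (proj₁ (onX y m yRm) , ¬accy) yRm))

  wellFounded⇒wellFoundedOn : WellFounded R → (X : Pred A ℓ) → WellFoundedOn X R
  wellFounded⇒wellFoundedOn wf X P _ (p , Pp) with em (∃ λ m → P m × (∀ y → P y → ¬ R y m))
  ... | yes minimal = minimal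
  ... | no noMinimal = ⊥-elim (All.wfRec wf ℓ (λ x → ¬ P x)
          (λ x ih Px → noMinimal (x , Px , λ y Py yRx → ih yRx Py)) p Pp)

supportOrdering-⇒ : ∀ {ℓ} {S : Set ℓ} {f : Pred S ℓ → Pred S ℓ} {X : Pred S ℓ} {R R′ : Rel S ℓ} →
  Monotone f → SupportOrdering f X R → RelOn X R′ → R ⇒ R′ → SupportOrdering f X R′
supportOrdering-⇒ mono (_ , support) onX′ R⇒R′ =
  onX′ , λ x x∈X → mono _ _ (λ (x′∈X , x′Rx) → x′∈X , R⇒R′ x′Rx) (support x x∈X)

module Rank {ℓ : Level} (em : ExcludedMiddle ℓ) {S : Set ℓ} (_≺_ : Rel S ℓ) (wf : WellFounded _≺_) where

  open All wf ℓ using (wfRec)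

  infix 4 _≤ʳ_ _<ʳ_

  -- x ≤ʳ y and x <ʳ y compare the ordinal ranks of x and y with respect to ≺,
  -- without constructing ordinals.
  mutual
    data _≤ʳ_ : Rel S ℓ where
      ≤ʳ-intro : ∀ {x y} → (∀ {x′} → x′ ≺ x → x′ <ʳ y) → x ≤ʳ y

    _<ʳ_ : Rel S ℓ
    x <ʳ y = ∃ λ y′ → y′ ≺ y × x ≤ʳ y′

  ≤ʳ-refl : ∀ x → x ≤ʳ x
  ≤ʳ-refl = wfRec _ λ x ih → ≤ʳ-intro λ {x′} x′≺x → x′ , x′≺x , ih x′≺x

  ≤ʳ-trans : ∀ {x y z} → x ≤ʳ y → y ≤ʳ z → x ≤ʳ z
  ≤ʳ-trans (≤ʳ-intro below) (≤ʳ-intro below′) = ≤ʳ-intro λ x′≺x → step (below x′≺x)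
    where
    step : ∀ {x′} → x′ <ʳ _ → x′ <ʳ _
    step (y′ , y′≺y , x′≤y′) with below′ y′≺y
    ... | (z′ , z′≺z , y′≤z′) = z′ , z′≺z , ≤ʳ-trans x′≤y′ y′≤z′

  ≤ʳ-≺-trans : ∀ {x y y′} → x ≤ʳ y′ → y′ ≺ y → x ≤ʳ y
  ≤ʳ-≺-trans (≤ʳ-intro below) y′≺y = ≤ʳ-intro λ x′≺x → step (below x′≺x)
    where
    step : ∀ {x′} → x′ <ʳ _ → x′ <ʳ _
    step (y″ , y″≺y′ , x′≤y″) = _ , y′≺y , ≤ʳ-≺-trans x′≤y″ y″≺y′

  ≺⇒<ʳ : ∀ {x y} → x ≺ y → x <ʳ y
  ≺⇒<ʳ {x} x≺y = x , x≺y , ≤ʳ-refl x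

  <ʳ⇒≤ʳ : ∀ {x y} → x <ʳ y → x ≤ʳ y
  <ʳ⇒≤ʳ (_ , y′≺y , x≤y′) = ≤ʳ-≺-trans x≤y′ y′≺y

  ≤ʳ-<ʳ-trans : ∀ {x y z} → x ≤ʳ y → y <ʳ z → x <ʳ z
  ≤ʳ-<ʳ-trans x≤y (z′ , z′≺z , y≤z′) = z′ , z′≺z , ≤ʳ-trans x≤y y≤z′

  <ʳ-≤ʳ-trans : ∀ {x y z} → x <ʳ y → y ≤ʳ z → x <ʳ z
  <ʳ-≤ʳ-trans (y′ , y′≺y , x≤y′) (≤ʳ-intro below) = ≤ʳ-<ʳ-trans x≤y′ (below y′≺y)

  acc-≤ʳ : ∀ {x y} → x ≤ʳ y → Acc _<ʳ_ y → Acc _<ʳ_ x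
  acc-≤ʳ x≤y acc-y = acc λ z<x → acc-inverse acc-y (<ʳ-≤ʳ-trans z<x x≤y)

  <ʳ-wellFounded : WellFounded _<ʳ_
  <ʳ-wellFounded = wfRec _ λ x ih → acc λ (_ , y′≺x , z≤y′) → acc-≤ʳ z≤y′ (ih y′≺x)

  <ʳ-irrefl : ∀ {x} → ¬ x <ʳ x
  <ʳ-irrefl x<x = wf⇒asym <ʳ-wellFounded x<x x<x

  ≰ʳ⇒∃≮ʳ : ∀ {x y} → ¬ x ≤ʳ y → ∃ λ x′ → x′ ≺ x × ¬ x′ <ʳ y
  ≰ʳ⇒∃≮ʳ {x} {y} x≰y with em (∃ λ x′ → x′ ≺ x × ¬ x′ <ʳ y)
  ... | yes witness = witness
  ... | no noWitness = ⊥-elim (x≰y (≤ʳ-intro λ {x′} x′≺x →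
          decidable-stable (em (x′ <ʳ y)) λ x′≮y → noWitness (x′ , x′≺x , x′≮y)))

  ≤ʳ-total : ∀ x y → x ≤ʳ y ⊎ y <ʳ x
  ≤ʳ-total = wfRec _ step
    where
    step : ∀ x → (∀ {x′} → x′ ≺ x → ∀ y → x′ ≤ʳ y ⊎ y <ʳ x′) → ∀ y → x ≤ʳ y ⊎ y <ʳ x
    step x ih y with em (x ≤ʳ y)
    ... | yes x≤y = inj₁ x≤y
    ... | no x≰y with ≰ʳ⇒∃≮ʳ x≰y
    ...   | (x′ , x′≺x , x′≮y) = inj₂ (x′ , x′≺x , ≤ʳ-intro λ {y′} y′≺y →
              [ (λ x′≤y′ → ⊥-elim (x′≮y (y′ , y′≺y , x′≤y′))) , id ]′ (ih x′≺x y′))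

module RankThenTieBreak {ℓ : Level} (em : ExcludedMiddle ℓ) {S : Set ℓ}
  {X : Pred S ℓ} {_≺_ : Rel S ℓ} (onX : RelOn X _≺_) (wf : WellFounded _≺_)
  {W : Rel S ℓ} (W-wellOrdering : WellOrderingOn (λ _ → ⊤) W) where

  open Rank em _≺_ wf

  private
    W-irrefl : ∀ x → ⊤ → ¬ W x x
    W-irrefl = proj₁ (proj₁ W-wellOrdering)

    W-trans : ∀ x y z → ⊤ → ⊤ → ⊤ → W x y → W y z → W x z
    W-trans = proj₁ (proj₂ (proj₁ W-wellOrdering))

    W-total : ∀ x y → ⊤ → ⊤ → ¬ x ≡ y → W x y ⊎ W y x
    W-total = proj₂ (proj₂ (proj₁ W-wellOrdering))

    W-wellFounded : WellFoundedOn (λ _ → ⊤) W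
    W-wellFounded = proj₂ W-wellOrdering

  infix 4 _<ˡ_ _⊏_

  _<ˡ_ : Rel S ℓ
  x <ˡ y = x <ʳ y ⊎ (x ≤ʳ y × y ≤ʳ x × W x y)

  _⊏_ : Rel S ℓ
  x ⊏ y = X x × X y × x <ˡ y

  <ˡ-trans : ∀ {x y z} → x <ˡ y → y <ˡ z → x <ˡ z
  <ˡ-trans (inj₁ x<y) (inj₁ y<z) = inj₁ (≤ʳ-<ʳ-trans (<ʳ⇒≤ʳ x<y) y<z)
  <ˡ-trans (inj₁ x<y) (inj₂ (y≤z , _ , _)) = inj₁ (<ʳ-≤ʳ-trans x<y y≤z)
  <ˡ-trans (inj₂ (x≤y , _ , _)) (inj₁ y<z) = inj₁ (≤ʳ-<ʳ-trans x≤y y<z)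
  <ˡ-trans {x} {y} {z} (inj₂ (x≤y , y≤x , xWy)) (inj₂ (y≤z , z≤y , yWz)) =
    inj₂ (≤ʳ-trans x≤y y≤z , ≤ʳ-trans z≤y y≤x , W-trans x y z tt tt tt xWy yWz)

  ⊏-totalOrderOn : TotalOrderOn X _⊏_
  ⊏-totalOrderOn = irrefl , trans , total
    where
    trans : ∀ x y z → X x → X y → X z → x ⊏ y → y ⊏ z → x ⊏ z
    trans _ _ _ x∈X _ z∈X (_ , _ , x<y) (_ , _ , y<z) = x∈X , z∈X , <ˡ-trans x<y y<z

    irrefl : ∀ x → X x → ¬ x ⊏ x
    irrefl x _ (_ , _ , inj₁ x<x) = <ʳ-irrefl x<x
    irrefl x _ (_ , _ , inj₂ (_ , _ , xWx)) = W-irrefl x tt xWx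

    total : ∀ x y → X x → X y → ¬ x ≡ y → x ⊏ y ⊎ y ⊏ x
    total x y x∈X y∈X x≢y with ≤ʳ-total x y | ≤ʳ-total y x
    ... | inj₂ y<x | _ = inj₂ (y∈X , x∈X , inj₁ y<x)
    ... | inj₁ _ | inj₂ x<y = inj₁ (x∈X , y∈X , inj₁ x<y)
    ... | inj₁ x≤y | inj₁ y≤x with W-total x y tt tt x≢y
    ...   | inj₁ xWy = inj₁ (x∈X , y∈X , inj₂ (x≤y , y≤x , xWy))
    ...   | inj₂ yWx = inj₂ (y∈X , x∈X , inj₂ (y≤x , x≤y , yWx))

  -- Take a rank-minimal m ∈ P, then the W-least element of P of rank at most that of m.
  ⊏-wellFoundedOn : WellFoundedOn X _⊏_
  ⊏-wellFoundedOn P P⊆X nonempty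
    with wellFounded⇒wellFoundedOn em <ʳ-wellFounded X P P⊆X nonempty
  ... | (m , m∈P , m-minimal)
    with W-wellFounded (λ z → P z × z ≤ʳ m) (λ _ → tt) (m , m∈P , ≤ʳ-refl m)
  ... | (n , (n∈P , n≤m) , n-minimal) = n , n∈P , n-⊏-minimal
    where
    n-⊏-minimal : ∀ y → P y → ¬ y ⊏ n
    n-⊏-minimal y y∈P (_ , _ , inj₁ y<n) = m-minimal y y∈P (<ʳ-≤ʳ-trans y<n n≤m)
    n-⊏-minimal y y∈P (_ , _ , inj₂ (y≤n , _ , yWn)) = n-minimal y (y∈P , ≤ʳ-trans y≤n n≤m) yWn

  ≺⇒⊏ : _≺_ ⇒ _⊏_
  ≺⇒⊏ {x} {y} x≺y = proj₁ (onX x y x≺y) , proj₂ (onX x y x≺y) , inj₁ (≺⇒<ʳ x≺y)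

  ⊏-relOn : RelOn X _⊏_
  ⊏-relOn _ _ (x∈X , y∈X , _) = x∈X , y∈X

lemma10 : ∀ {ℓ : Level} → ExcludedMiddle ℓ → WellOrderingTheorem ℓ →
    (S : Set ℓ) (f : Pred S ℓ → Pred S ℓ) → Monotone f →
    (X : Pred S ℓ) (_≺_ : Rel S ℓ) → SupportOrdering f X _≺_ → WellFoundedOn X _≺_ →
    Σ (Rel S ℓ) λ _≺′_ → WellOrderingOn X _≺′_ × (_≺_ ⇒ _≺′_) × SupportOrdering f X _≺′_
lemma10 em zermelo S f mono X _≺_ support@(onX , _) wfOn =
  _⊏_ , (⊏-totalOrderOn , ⊏-wellFoundedOn) , ≺⇒⊏ , supportOrdering-⇒ mono support ⊏-relOn ≺⇒⊏
  where
  open RankThenTieBreak em onX (wellFoundedOn⇒wellFounded em onX wfOn) (proj₂ (zermelo S))
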